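{- Let $R$ be a finite commutative ring with unity, $I$ an ideal of $R$, and $G=\Gamma_I(R)$. Let $C_1,\dots,C_k$ be the twin classes of $G$, $n_i=|C_i|$, $c_i\in C_i$ representatives and $H=G[\{c_1,\dots,c_k\}]$. Then $$W(G)=\sum_{\substack{1\le i\le k\\ G[C_i]\text{ complete}}}\binom{n_i}{2}+\sum_{\substack{1\le i\le k\\ G[C_i]\text{ edgeless}}}2\binom{n_i}{2}+\sum_{1\le i<j\le k}n_in_j\,d_H(c_i,c_j).$$
   Context: The ideal-based zero-divisor graph $\Gamma_I(R)$ has vertex set $\{x\in R\setminus I: xy\in I \text{ for some } y\in R\setminus I\}$, distinct $x,y$ adjacent iff $xy\in I$. Twin classes of a graph are the classes of the equivalence relation $u\sim v$ iff $N(u)\setminus\{v\}=N(v)\setminus\{u\}$ ($N$ = open neighbourhood); each induced subgraph on a twin class is complete or edgeless. $W$ denotes the Wiener index (sum of distances over unordered pairs of vertices) and $d_H$ graph distance in $H$. -}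

module Defs where

open import Data.Nat as ℕ using (ℕ; zero; suc)
open import Data.Nat.Combinatorics using (_C_)
open import Data.Fin using (Fin; _<_)
open import Data.Fin.Properties using (_≟_; _<?_; any?; all?)
open import Data.Fin.Subset using (Subset; _∈_; _∉_)
open import Data.Fin.Subset.Properties using (_∈?_)
open import Data.Bool using (Bool; true; false; _∧_; if_then_else_)
open import Data.List using (List; map; filter; allFin; cartesianProduct)
open import Data.Nat.ListAction using (sum)
open import Data.Bool.ListAction using (any)
open import Data.Product using (_×_; _,_; ∃; proj₁; proj₂; uncurry)
open import Algebra.Structures using (IsCommutativeRing)
open import Relation.Binary.PropositionalEquality using (_≡_; _≢_)
open import Relation.Nullary using (Dec; does; ¬_; ¬?)
open import Relation.Nullary.Decidable using (_×-dec_; _→-dec_)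

-- A finite commutative ring with unity, presented on the carrier Fin m
-- (every finite commutative ring is isomorphic to one of this form).

record FinCommRing (m : ℕ) : Set where
  infixl 7 _*_
  infixl 6 _+_
  field
    _+_ _*_ : Fin m → Fin m → Fin m
    -_      : Fin m → Fin m
    0# 1#   : Fin m
    isCommutativeRing : IsCommutativeRing _≡_ _+_ _*_ -_ 0# 1#

-- An ideal: an additive subgroup closed under multiplication by ring
-- elements (closure under negation follows from r = -1).
record Ideal {m : ℕ} (R : FinCommRing m) : Set where
  open FinCommRing R
  field
    carrier  : Subset m
    0∈       : 0# ∈ carrier
    +-closed : ∀ {x y} → x ∈ carrier → y ∈ carrier → (x + y) ∈ carrier
    *-closed : ∀ r {x} → x ∈ carrier → (r * x) ∈ carrier

record FinGraph (m : ℕ) : Set₁ where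
  field
    V    : Fin m → Set
    V?   : ∀ x → Dec (V x)
    Adj  : Fin m → Fin m → Set
    Adj? : ∀ x y → Dec (Adj x y)
open FinGraph public

module _ {m : ℕ} (R : FinCommRing m) (I : Ideal R) where
  open FinCommRing R
  private
    S = Ideal.carrier I

  ΓV : Fin m → Set
  ΓV x = x ∉ S × ∃ λ y → y ∉ S × (x * y) ∈ S

  ΓV? : ∀ x → Dec (ΓV x)
  ΓV? x = ¬? (x ∈? S) ×-dec any? (λ y → ¬? (y ∈? S) ×-dec ((x * y) ∈? S))

  ΓAdj : Fin m → Fin m → Set
  ΓAdj x y = ΓV x × ΓV y × x ≢ y × (x * y) ∈ S

  ΓAdj? : ∀ x y → Dec (ΓAdj x y)
  ΓAdj? x y = ΓV? x ×-dec ΓV? y ×-dec ¬? (x ≟ y) ×-dec ((x * y) ∈? S)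

  Γ : FinGraph m
  Γ = record { V = ΓV ; V? = ΓV? ; Adj = ΓAdj ; Adj? = ΓAdj? }

induced : ∀ {m} (G : FinGraph m) (P : Fin m → Set) → (∀ x → Dec (P x)) → FinGraph m
induced G P P? = record
  { V    = λ x → V G x × P x
  ; V?   = λ x → V? G x ×-dec P? x
  ; Adj  = λ x y → Adj G x y × P x × P y
  ; Adj? = λ x y → Adj? G x y ×-dec P? x ×-dec P? y
  }

walkOfLength : ∀ {m} → FinGraph m → ℕ → Fin m → Fin m → Bool
walkOfLength {m} G zero    u v = does (u ≟ v)
walkOfLength {m} G (suc k) u v =
  any (λ w → does (Adj? G u w) ∧ walkOfLength G k w v) (allFin m)

-- In a graph on at most
-- m vertices such a least length is < m whenever a walk exists; for
-- unreachable pairs the (irrelevant) default value 0 is returned.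
dist : ∀ {m} → FinGraph m → Fin m → Fin m → ℕ
dist {m} G u v = go 0 (suc m)
  where
  go : ℕ → ℕ → ℕ
  go k zero     = 0
  go k (suc fuel) = if walkOfLength G k u v then k else go (suc k) fuel

W : ∀ {m} → FinGraph m → ℕ
W {m} G = sum (map (uncurry (dist G))
              (filter (λ p → (proj₁ p <? proj₂ p) ×-dec V? G (proj₁ p) ×-dec V? G (proj₂ p))
                      (cartesianProduct (allFin m) (allFin m))))

Twin : ∀ {m} → FinGraph m → Fin m → Fin m → Set
Twin G u v = ∀ w → ((Adj G u w × w ≢ v) → (Adj G v w × w ≢ u))
                 × ((Adj G v w × w ≢ u) → (Adj G u w × w ≢ v))

Twin? : ∀ {m} (G : FinGraph m) u v → Dec (Twin G u v)
Twin? G u v = all? λ w →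
  ((Adj? G u w ×-dec ¬? (w ≟ v)) →-dec (Adj? G v w ×-dec ¬? (w ≟ u)))
  ×-dec ((Adj? G v w ×-dec ¬? (w ≟ u)) →-dec (Adj? G u w ×-dec ¬? (w ≟ v)))

module _ {m : ℕ} (G : FinGraph m) where

  inClass : Fin m → Fin m → Set
  inClass c v = V G v × Twin G v c

  inClass? : ∀ c v → Dec (inClass c v)
  inClass? c v = V? G v ×-dec Twin? G v c

  classSize : Fin m → ℕ
  classSize c = Data.List.length (filter (inClass? c) (allFin m))

  ClassComplete : Fin m → Set
  ClassComplete c = ∀ u v → inClass c u → inClass c v → u ≢ v → Adj G u v

  ClassComplete? : ∀ c → Dec (ClassComplete c)
  ClassComplete? c = all? λ u → all? λ v →
    inClass? c u →-dec inClass? c v →-dec ¬? (u ≟ v) →-dec Adj? G u v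

  ClassEdgeless : Fin m → Set
  ClassEdgeless c = ∀ u v → inClass c u → inClass c v → ¬ Adj G u v

  ClassEdgeless? : ∀ c → Dec (ClassEdgeless c)
  ClassEdgeless? c = all? λ u → all? λ v →
    inClass? c u →-dec inClass? c v →-dec ¬? (Adj? G u v)

  repGraph : ∀ {k} → (Fin k → Fin m) → FinGraph m
  repGraph {k} c = induced G (λ x → ∃ λ i → c i ≡ x) (λ x → any? (λ i → c i ≟ x))

  twinFormula : (k : ℕ) → (Fin k → Fin m) → ℕ
  twinFormula k c =
      sum (map (λ i → if does (ClassComplete? (c i)) then classSize (c i) C 2 else 0) (allFin k))
    ℕ.+ sum (map (λ i → if does (ClassEdgeless? (c i)) then 2 ℕ.* (classSize (c i) C 2) else 0) (allFin k))
    ℕ.+ sum (map (λ p → classSize (c (proj₁ p)) ℕ.* classSize (c (proj₂ p))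
                        ℕ.* dist (repGraph c) (c (proj₁ p)) (c (proj₂ p)))
               (filter (λ p → proj₁ p <? proj₂ p) (cartesianProduct (allFin k) (allFin k))))

-- Inside a class, either all
-- pairs are adjacent (distance 1), or none is; then two twins share a neighbour, since G is
-- connected, and are at distance 2.  Vertices in different classes are as far apart as their
-- representatives in H: a walk of G projects to a no longer walk of H between the
-- representatives, and a walk of H lifts back after exchanging its end points for twins.
-- Summing over ordered pairs of distinct vertices, 2 W(G) is
--   Σᵢ δᵢ nᵢ(nᵢ − 1) + Σ_{i ≠ j} nᵢ nⱼ d_H(cᵢ, cⱼ),   δᵢ = 1 if G[Cᵢ] is complete, else 2,
-- which is twice the stated formula (a class that is both complete and edgeless has nᵢ ≤ 1).

module Submission where

open import Defs
open import Algebra.Structures using (IsCommutativeRing)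
open import Data.Bool using (Bool; T; true; false; _∧_; not; if_then_else_)
open import Data.Bool.Properties using (T-∧)
open import Data.Fin using (Fin; zero; suc)
open import Data.Fin.Properties using (_≟_; _<?_; <-cmp; <⇒≢; toℕ<n)
open import Data.Fin.Subset using (_∈_; _∉_)
open import Data.Fin.Subset.Properties using (_∈?_)
open import Data.List using (List; []; _∷_; _++_; map; filter; tabulate; allFin; cartesianProduct; length)
open import Data.List.Membership.Propositional using (lose)
open import Data.List.Membership.Propositional.Properties using (∈-allFin)
open import Data.List.Properties using (map-++; map-∘)
open import Data.List.Relation.Unary.Any using (satisfied)
open import Data.List.Relation.Unary.Any.Properties using (any⁺; any⁻)
open import Data.Nat using (ℕ; zero; suc; _+_; _*_; _≤_; _<_; z≤n; s≤s)
open import Data.Nat.Combinatorics using (_C_; nC1≡n; nCk+nC[k+1]≡[n+1]C[k+1])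
open import Data.Nat.ListAction using (sum)
open import Data.Nat.ListAction.Properties using (sum-++)
open import Data.Nat.Properties
  using ( +-*-semiring; +-identityʳ; *-identityˡ; *-identityʳ; *-zeroʳ; *-assoc; *-comm; *-distribˡ-+; *-distribʳ-+
        ; +-cancelʳ-≡; *-cancelˡ-≡; ≤-refl; ≤-trans; ≤-<-trans; n≤1+n; m≤n⇒m≤1+n; m≤n⇒m<n∨m≡n)
open import Algebra.Properties.Semiring.Sum +-*-semiring
  using (sum-syntax; sum-cong-≗; sum-replicate-zero; ∑-distrib-+; ∑-comm; *-distribˡ-sum; *-distribʳ-sum)
open import Data.Nat.Tactic.RingSolver using (solve-∀)
open import Data.Product using (_×_; _,_; ∃; proj₁; proj₂)
open import Data.Sum using (inj₁; inj₂)
open import Function using (_∘_)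
open import Function.Bundles using (mk⇔; module Equivalence)
open import Relation.Binary using (tri<; tri≈; tri>)
open import Relation.Binary.PropositionalEquality
open import Relation.Nullary using (Dec; does; yes; no; ¬_; ¬?; contradiction; _×-dec_)
open import Relation.Nullary.Decidable using (does-⇔; dec-true; dec-false; map′; T?)
open import Relation.Unary using (Decidable)

⟦_⟧ : Bool → ℕ
⟦ true ⟧  = 1
⟦ false ⟧ = 0

⟦∧⟧ : ∀ a b → ⟦ a ∧ b ⟧ ≡ ⟦ a ⟧ * ⟦ b ⟧
⟦∧⟧ true  b = sym (+-identityʳ ⟦ b ⟧)
⟦∧⟧ false b = refl

⟦not⟧+⟦⟧ : ∀ b → ⟦ not b ⟧ + ⟦ b ⟧ ≡ 1
⟦not⟧+⟦⟧ true  = refl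
⟦not⟧+⟦⟧ false = refl

⟦⟧-idem : ∀ b → ⟦ b ⟧ * ⟦ b ⟧ ≡ ⟦ b ⟧
⟦⟧-idem true  = refl
⟦⟧-idem false = refl

⟦yes⟧ : ∀ {P : Set} (P? : Dec P) → P → ⟦ does P? ⟧ ≡ 1
⟦yes⟧ P? p = cong ⟦_⟧ (dec-true P? p)

⟦no⟧ : ∀ {P : Set} (P? : Dec P) → ¬ P → ⟦ does P? ⟧ ≡ 0
⟦no⟧ P? ¬p = cong ⟦_⟧ (dec-false P? ¬p)

∑-indicator : ∀ {n} (j : Fin n) (f : Fin n → ℕ) → ∑[ i < n ] (⟦ does (j ≟ i) ⟧ * f i) ≡ f j
∑-indicator {suc n} zero    f = begin
  (f zero + 0) + ∑[ i < n ] 0 ≡⟨ cong₂ _+_ (+-identityʳ (f zero)) (sum-replicate-zero n) ⟩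
  f zero + 0                  ≡⟨ +-identityʳ (f zero) ⟩
  f zero                      ∎
  where open ≡-Reasoning
∑-indicator {suc n} (suc j) f = ∑-indicator j (f ∘ suc)

sum-map-tabulate : ∀ {n} {A : Set} (f : A → ℕ) (g : Fin n → A) → sum (map f (tabulate g)) ≡ ∑[ i < n ] f (g i)
sum-map-tabulate {zero}  f g = refl
sum-map-tabulate {suc n} f g = cong (f (g zero) +_) (sum-map-tabulate f (g ∘ suc))

sum-map-filter : ∀ {A : Set} {P : A → Set} (P? : ∀ x → Dec (P x)) (f : A → ℕ) (xs : List A) →
                 sum (map f (filter P? xs)) ≡ sum (map (λ x → ⟦ does (P? x) ⟧ * f x) xs)
sum-map-filter P? f []       = refl
sum-map-filter P? f (x ∷ xs) with does (P? x)
... | true  = cong₂ _+_ (sym (+-identityʳ (f x))) (sum-map-filter P? f xs)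
... | false = sum-map-filter P? f xs

length-filter : ∀ {A : Set} {P : A → Set} (P? : ∀ x → Dec (P x)) (xs : List A) →
                length (filter P? xs) ≡ sum (map (λ x → ⟦ does (P? x) ⟧) xs)
length-filter P? []       = refl
length-filter P? (x ∷ xs) with does (P? x)
... | true  = cong suc (length-filter P? xs)
... | false = length-filter P? xs

sum-map-cartesianProduct : ∀ {A B : Set} (f : A × B → ℕ) (xs : List A) (ys : List B) →
  sum (map f (cartesianProduct xs ys)) ≡ sum (map (λ x → sum (map (λ y → f (x , y)) ys)) xs)
sum-map-cartesianProduct f []       ys = refl
sum-map-cartesianProduct f (x ∷ xs) ys = begin
  sum (map f (map (x ,_) ys ++ cartesianProduct xs ys))
    ≡⟨ cong sum (map-++ f (map (x ,_) ys) _) ⟩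
  sum (map f (map (x ,_) ys) ++ map f (cartesianProduct xs ys))
    ≡⟨ sum-++ (map f (map (x ,_) ys)) _ ⟩
  sum (map f (map (x ,_) ys)) + sum (map f (cartesianProduct xs ys))
    ≡⟨ cong₂ _+_ (cong sum (sym (map-∘ ys))) (sum-map-cartesianProduct f xs ys) ⟩
  sum (map (λ y → f (x , y)) ys) + sum (map (λ x → sum (map (λ y → f (x , y)) ys)) xs) ∎
  where open ≡-Reasoning

sum-filter-allFin² : ∀ {m n} {P : Fin m × Fin n → Set} (P? : ∀ p → Dec (P p)) (f : Fin m × Fin n → ℕ) →
  sum (map f (filter P? (cartesianProduct (allFin m) (allFin n))))
    ≡ ∑[ i < m ] ∑[ j < n ] (⟦ does (P? (i , j)) ⟧ * f (i , j))
sum-filter-allFin² {m} {n} P? f = begin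
  sum (map f (filter P? (cartesianProduct (allFin m) (allFin n))))
    ≡⟨ sum-map-filter P? f (cartesianProduct (allFin m) (allFin n)) ⟩
  sum (map g (cartesianProduct (allFin m) (allFin n)))
    ≡⟨ sum-map-cartesianProduct g (allFin m) (allFin n) ⟩
  sum (map (λ i → sum (map (λ j → g (i , j)) (allFin n))) (allFin m))
    ≡⟨ sum-map-tabulate (λ i → sum (map (λ j → g (i , j)) (allFin n))) (λ i → i) ⟩
  ∑[ i < m ] sum (map (λ j → g (i , j)) (allFin n))
    ≡⟨ sum-cong-≗ (λ i → sum-map-tabulate (λ j → g (i , j)) (λ j → j)) ⟩
  ∑[ i < m ] ∑[ j < n ] g (i , j) ∎
  where
  open ≡-Reasoning
  g : Fin m × Fin n → ℕ
  g p = ⟦ does (P? p) ⟧ * f p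

⟦<⟧+⟦>⟧ : ∀ {n} (i j : Fin n) → ⟦ does (i <? j) ⟧ + ⟦ does (j <? i) ⟧ ≡ ⟦ not (does (i ≟ j)) ⟧
⟦<⟧+⟦>⟧ i j with <-cmp i j
... | tri< i<j _ j≮i = begin
  ⟦ does (i <? j) ⟧ + ⟦ does (j <? i) ⟧ ≡⟨ cong₂ _+_ (⟦yes⟧ (i <? j) i<j) (⟦no⟧ (j <? i) j≮i) ⟩
  1                                     ≡⟨ cong (λ b → ⟦ not b ⟧) (dec-false (i ≟ j) (<⇒≢ i<j)) ⟨
  ⟦ not (does (i ≟ j)) ⟧                ∎
  where open ≡-Reasoning
... | tri> i≮j _ j<i = begin
  ⟦ does (i <? j) ⟧ + ⟦ does (j <? i) ⟧ ≡⟨ cong₂ _+_ (⟦no⟧ (i <? j) i≮j) (⟦yes⟧ (j <? i) j<i) ⟩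
  1                                     ≡⟨ cong (λ b → ⟦ not b ⟧) (dec-false (i ≟ j) (≢-sym (<⇒≢ j<i))) ⟨
  ⟦ not (does (i ≟ j)) ⟧                ∎
  where open ≡-Reasoning
... | tri≈ i≮j refl _ = begin
  ⟦ does (i <? i) ⟧ + ⟦ does (i <? i) ⟧ ≡⟨ cong₂ _+_ (⟦no⟧ (i <? i) i≮j) (⟦no⟧ (i <? i) i≮j) ⟩
  0                                     ≡⟨ cong (λ b → ⟦ not b ⟧) (dec-true (i ≟ i) refl) ⟨
  ⟦ not (does (i ≟ i)) ⟧                ∎
  where open ≡-Reasoning

∑-upper-triangle : ∀ {n} (t : Fin n → Fin n → ℕ) → (∀ i j → t i j ≡ t j i) →
  2 * ∑[ i < n ] ∑[ j < n ] (⟦ does (i <? j) ⟧ * t i j)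
    ≡ ∑[ i < n ] ∑[ j < n ] (⟦ not (does (i ≟ j)) ⟧ * t i j)
∑-upper-triangle {n} t t-sym = begin
  2 * ∑[ i < n ] upper i                  ≡⟨ cong (∑[ i < n ] upper i +_) (+-identityʳ _) ⟩
  ∑[ i < n ] upper i + ∑[ i < n ] upper i ≡⟨ cong (∑[ i < n ] upper i +_) upper≡lower ⟩
  ∑[ i < n ] upper i + ∑[ i < n ] lower i ≡⟨ ∑-distrib-+ upper lower ⟨
  ∑[ i < n ] (upper i + lower i)          ≡⟨ sum-cong-≗ row ⟩
  ∑[ i < n ] ∑[ j < n ] (⟦ not (does (i ≟ j)) ⟧ * t i j) ∎
  where
  open ≡-Reasoning
  upper lower : Fin n → ℕ
  upper i = ∑[ j < n ] (⟦ does (i <? j) ⟧ * t i j)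
  lower i = ∑[ j < n ] (⟦ does (j <? i) ⟧ * t i j)
  upper≡lower : ∑[ i < n ] upper i ≡ ∑[ i < n ] lower i
  upper≡lower = trans (∑-comm (λ i j → ⟦ does (i <? j) ⟧ * t i j))
                      (sum-cong-≗ λ j → sum-cong-≗ λ i → cong (⟦ does (i <? j) ⟧ *_) (t-sym i j))
  row : ∀ i → upper i + lower i ≡ ∑[ j < n ] (⟦ not (does (i ≟ j)) ⟧ * t i j)
  row i = trans (sym (∑-distrib-+ (λ j → ⟦ does (i <? j) ⟧ * t i j) (λ j → ⟦ does (j <? i) ⟧ * t i j)))
                (sum-cong-≗ λ j → trans (sym (*-distribʳ-+ (t i j) ⟦ does (i <? j) ⟧ _)) (cong (_* t i j) (⟦<⟧+⟦>⟧ i j)))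

⟦not⟧*+⟦⟧* : ∀ b x → ⟦ not b ⟧ * x + ⟦ b ⟧ * x ≡ x
⟦not⟧*+⟦⟧* b x = trans (sym (*-distribʳ-+ x ⟦ not b ⟧ ⟦ b ⟧)) (trans (cong (_* x) (⟦not⟧+⟦⟧ b)) (*-identityˡ x))

∑*∑ : ∀ {m n} (f : Fin m → ℕ) (g : Fin n → ℕ) → ∑[ i < m ] f i * ∑[ j < n ] g j ≡ ∑[ i < m ] ∑[ j < n ] (f i * g j)
∑*∑ {m} {n} f g = trans (*-distribʳ-sum (∑[ j < n ] g j) f) (sum-cong-≗ (λ i → *-distribˡ-sum (f i) g))

∑²-comm : ∀ {m n} (f : Fin m → Fin m → Fin n → Fin n → ℕ) →
  ∑[ u < m ] ∑[ v < m ] ∑[ i < n ] ∑[ j < n ] f u v i j ≡ ∑[ i < n ] ∑[ j < n ] ∑[ u < m ] ∑[ v < m ] f u v i j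
∑²-comm {m} {n} f = begin
  ∑[ u < m ] ∑[ v < m ] ∑[ i < n ] ∑[ j < n ] f u v i j
    ≡⟨ sum-cong-≗ (λ u → ∑-comm (λ v i → ∑[ j < n ] f u v i j)) ⟩
  ∑[ u < m ] ∑[ i < n ] ∑[ v < m ] ∑[ j < n ] f u v i j
    ≡⟨ ∑-comm (λ u i → ∑[ v < m ] ∑[ j < n ] f u v i j) ⟩
  ∑[ i < n ] ∑[ u < m ] ∑[ v < m ] ∑[ j < n ] f u v i j
    ≡⟨ sum-cong-≗ (λ i → sum-cong-≗ (λ u → ∑-comm (λ v j → f u v i j))) ⟩
  ∑[ i < n ] ∑[ u < m ] ∑[ j < n ] ∑[ v < m ] f u v i j
    ≡⟨ sum-cong-≗ (λ i → ∑-comm (λ u j → ∑[ v < m ] f u v i j)) ⟩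
  ∑[ i < n ] ∑[ j < n ] ∑[ u < m ] ∑[ v < m ] f u v i j ∎
  where open ≡-Reasoning

*-distrib-∑∑ : ∀ {n} x (y z : Fin n → ℕ) (w : Fin n → Fin n → ℕ) →
  x * ∑[ i < n ] (y i * ∑[ j < n ] (z j * w i j)) ≡ ∑[ i < n ] ∑[ j < n ] ((x * (y i * z j)) * w i j)
*-distrib-∑∑ {n} x y z w = trans (*-distribˡ-sum x (λ i → y i * ∑[ j < n ] (z j * w i j))) (sum-cong-≗ λ i → begin
  x * (y i * ∑[ j < n ] (z j * w i j))           ≡⟨ *-assoc x (y i) _ ⟨
  x * y i * ∑[ j < n ] (z j * w i j)             ≡⟨ *-distribˡ-sum (x * y i) (λ j → z j * w i j) ⟩
  ∑[ j < n ] (x * y i * (z j * w i j))           ≡⟨ sum-cong-≗ (λ j → regroup x (y i) (z j) (w i j)) ⟩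
  ∑[ j < n ] ((x * (y i * z j)) * w i j)         ∎)
  where
  open ≡-Reasoning
  regroup : ∀ a b c d → a * b * (c * d) ≡ (a * (b * c)) * d
  regroup = solve-∀

∑∑-*ʳ : ∀ {m n} (f : Fin m → Fin n → ℕ) x → ∑[ i < m ] ∑[ j < n ] (f i j * x) ≡ (∑[ i < m ] ∑[ j < n ] f i j) * x
∑∑-*ʳ {m} {n} f x = sym (trans (*-distribʳ-sum x (λ i → ∑[ j < n ] f i j)) (sum-cong-≗ λ i → *-distribʳ-sum x (f i)))

⟦⟧*-cong : ∀ {P : Set} (P? : Dec P) {x y} → (P → x ≡ y) → ⟦ does P? ⟧ * x ≡ ⟦ does P? ⟧ * y
⟦⟧*-cong (yes p) x≡y = cong (1 *_) (x≡y p)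
⟦⟧*-cong (no _)  _   = refl

2*C2+n≡n*n : ∀ n → 2 * (n C 2) + n ≡ n * n
2*C2+n≡n*n zero    = refl
2*C2+n≡n*n (suc n) = begin
  2 * (suc n C 2) + suc n        ≡⟨ cong (λ x → 2 * x + suc n) (nCk+nC[k+1]≡[n+1]C[k+1] n 1) ⟨
  2 * (n C 1 + n C 2) + suc n    ≡⟨ cong (λ x → 2 * (x + n C 2) + suc n) (nC1≡n n) ⟩
  2 * (n + n C 2) + suc n        ≡⟨ regroup n (n C 2) ⟩
  (2 * (n C 2) + n) + suc (n + n) ≡⟨ cong (_+ suc (n + n)) (2*C2+n≡n*n n) ⟩
  n * n + suc (n + n)            ≡⟨ square n ⟩
  suc n * suc n                  ∎
  where
  open ≡-Reasoning
  regroup : ∀ n c → 2 * (n + c) + suc n ≡ (2 * c + n) + suc (n + n)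
  regroup = solve-∀
  square : ∀ n → n * n + suc (n + n) ≡ suc n * suc n
  square = solve-∀

Least : (ℕ → Set) → ℕ → Set
Least P d = P d × (∀ {j} → j < d → ¬ P j)

least-witness : ∀ {P : ℕ → Set} → Decidable P → ∀ {n} → P n → ∃ λ d → d ≤ n × Least P d
least-witness P? {n} p with P? 0
... | yes p₀ = 0 , z≤n , p₀ , λ ()
least-witness P? {zero}  p | no ¬p₀ = contradiction p ¬p₀
least-witness {P} P? {suc n} p | no ¬p₀ with least-witness (P? ∘ suc) p
... | d , d≤n , pd , below = suc d , s≤s d≤n , pd , below′
  where
  below′ : ∀ {j} → j < suc d → ¬ P j
  below′ {zero}  _         = ¬p₀
  below′ {suc j} (s≤s j<d) = below j<d

T-does⇒ : ∀ {P : Set} (P? : Dec P) → T (does P?) → P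
T-does⇒ (yes p) _ = p

⇒T-does : ∀ {P : Set} (P? : Dec P) → P → T (does P?)
⇒T-does (yes _) _ = _
⇒T-does (no ¬p) p = contradiction p ¬p

module _ {m : ℕ} (G : FinGraph m) where

  infixr 5 _∷_
  data Walk : ℕ → Fin m → Fin m → Set where
    []  : ∀ {x} → Walk 0 x x
    _∷_ : ∀ {ℓ x y z} → Adj G x y → Walk ℓ y z → Walk (suc ℓ) x z

  walkOfLength⇒Walk : ∀ ℓ x y → T (walkOfLength G ℓ x y) → Walk ℓ x y
  walkOfLength⇒Walk zero x y t with x ≟ y
  ... | yes refl = []
  walkOfLength⇒Walk (suc ℓ) x y t
    with z , t′ ← satisfied (any⁻ (λ w → does (Adj? G x w) ∧ walkOfLength G ℓ w y) (allFin m) t)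
    with adj , rest ← Equivalence.to T-∧ t′
    = T-does⇒ (Adj? G x z) adj ∷ walkOfLength⇒Walk ℓ z y rest

  Walk⇒walkOfLength : ∀ {ℓ x y} → Walk ℓ x y → T (walkOfLength G ℓ x y)
  Walk⇒walkOfLength {x = x} [] = ⇒T-does (x ≟ x) refl
  Walk⇒walkOfLength {x = x} {y} (_∷_ {ℓ} {y = z} adj w) =
    any⁺ (λ w → does (Adj? G x w) ∧ walkOfLength G ℓ w y)
         (lose (∈-allFin z) (Equivalence.from T-∧ (⇒T-does (Adj? G x z) adj , Walk⇒walkOfLength w)))

  walk? : ∀ ℓ x y → Dec (Walk ℓ x y)
  walk? ℓ x y = map′ (walkOfLength⇒Walk ℓ x y) Walk⇒walkOfLength (T? (walkOfLength G ℓ x y))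

  IsDistance : Fin m → Fin m → ℕ → Set
  IsDistance u v = Least (λ ℓ → Walk ℓ u v)

  isDistance-exists : ∀ {ℓ u v} → Walk ℓ u v → ∃ λ d → d ≤ ℓ × IsDistance u v d
  isDistance-exists {u = u} {v} = least-witness (λ ℓ → walk? ℓ u v)

≢⇒2≤ : ∀ {n} {x y : Fin n} → x ≢ y → 2 ≤ n
≢⇒2≤ {suc zero}    {zero} {zero} x≢y = contradiction refl x≢y
≢⇒2≤ {suc (suc _)} _                 = s≤s (s≤s z≤n)

≢³⇒3≤ : ∀ {n} {x y z : Fin n} → x ≢ y → y ≢ z → x ≢ z → 3 ≤ n
≢³⇒3≤ {suc (suc (suc _))} _ _ _ = s≤s (s≤s (s≤s z≤n))
≢³⇒3≤ {suc zero}       {zero}     {zero}              x≢y _   _   = contradiction refl x≢y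
≢³⇒3≤ {suc (suc zero)} {zero}     {zero}              x≢y _   _   = contradiction refl x≢y
≢³⇒3≤ {suc (suc zero)} {suc zero} {suc zero}          x≢y _   _   = contradiction refl x≢y
≢³⇒3≤ {suc (suc zero)} {_}        {zero}     {zero}     _   y≢z _   = contradiction refl y≢z
≢³⇒3≤ {suc (suc zero)} {_}        {suc zero} {suc zero} _   y≢z _   = contradiction refl y≢z
≢³⇒3≤ {suc (suc zero)} {zero}     {_}        {zero}     _   _   x≢z = contradiction refl x≢z
≢³⇒3≤ {suc (suc zero)} {suc zero} {_}        {suc zero} _   _   x≢z = contradiction refl x≢z

-- `dist` only tries lengths up to m; a shortest walk of length 3 visits three distinct vertices.
isDistance≤order : ∀ {m} {G : FinGraph m} {u v d} → d ≤ 3 → IsDistance G u v d → d ≤ m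
isDistance≤order {d = zero} _ _ = z≤n
isDistance≤order {u = u} {d = suc zero} _ _ = ≤-trans (s≤s z≤n) (toℕ<n u)
isDistance≤order {u = u} {v} {d = suc (suc zero)} _ (_ , below) = ≢⇒2≤ {x = u} {v} λ where refl → below (s≤s z≤n) []
isDistance≤order {u = u} {v} {d = suc (suc (suc zero))} _ (_∷_ {y = y} a w , below) =
  ≢³⇒3≤ {x = u} {y} {v} (λ where refl → below (s≤s (s≤s (s≤s z≤n))) w)
        (λ where refl → below (s≤s (s≤s z≤n)) (a ∷ []))
        (λ where refl → below (s≤s z≤n) [])
isDistance≤order {d = suc (suc (suc (suc _)))} (s≤s (s≤s (s≤s ()))) _

-- `dist` is a bounded search local to its definition, so it can only be evaluated by
-- unfolding; this is why the bound d ≤ 3, and hence the diameter of Γ_I(R), is needed.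
dist-isDistance : ∀ {m} (G : FinGraph m) {u v d} → d ≤ 3 → IsDistance G u v d → dist G u v ≡ d
dist-isDistance {m} G {u} {v} d≤3 isd = unfold d≤3 (isDistance≤order d≤3 isd) isd
  where
  present : ∀ {ℓ} → Walk G ℓ u v → walkOfLength G ℓ u v ≡ true
  present {ℓ} = dec-true (walk? G ℓ u v)
  absent : ∀ {ℓ} → ¬ Walk G ℓ u v → walkOfLength G ℓ u v ≡ false
  absent {ℓ} = dec-false (walk? G ℓ u v)
  unfold : ∀ {d} → d ≤ 3 → d ≤ m → IsDistance G u v d → dist G u v ≡ d
  unfold {zero} _ _ (w , _) rewrite present w = refl
  unfold {suc zero} _ (s≤s _) (w , below)
    rewrite absent (below (s≤s z≤n)) | present w = refl
  unfold {suc (suc zero)} _ (s≤s (s≤s _)) (w , below)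
    rewrite absent (below (s≤s z≤n)) | absent (below (s≤s (s≤s z≤n))) | present w = refl
  unfold {suc (suc (suc zero))} _ (s≤s (s≤s (s≤s _))) (w , below)
    rewrite absent (below (s≤s z≤n)) | absent (below (s≤s (s≤s z≤n)))
          | absent (below (s≤s (s≤s (s≤s z≤n)))) | present w = refl
  unfold {suc (suc (suc (suc _)))} (s≤s (s≤s (s≤s ()))) _ _

ShorterWalks : ∀ {m n} → FinGraph m → Fin m → Fin m → FinGraph n → Fin n → Fin n → Set
ShorterWalks G u v G′ u′ v′ = ∀ {ℓ} → Walk G ℓ u v → ∃ λ ℓ′ → ℓ′ ≤ ℓ × Walk G′ ℓ′ u′ v′

isDistance-transfer : ∀ {m n} {G : FinGraph m} {G′ : FinGraph n} {u v u′ v′ d} →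
  ShorterWalks G u v G′ u′ v′ → ShorterWalks G′ u′ v′ G u v →
  IsDistance G u v d → IsDistance G′ u′ v′ d
isDistance-transfer {G′ = G′} {u′ = u′} {v′} {d} to from (w , below) with to w
... | ℓ′ , ℓ′≤d , w′ with m≤n⇒m<n∨m≡n ℓ′≤d
...   | inj₂ refl = w′ , below′
  where
  below′ : ∀ {j} → j < d → ¬ Walk G′ j u′ v′
  below′ j<d w″ with from w″
  ... | ℓ″ , ℓ″≤j , w‴ = below (≤-<-trans ℓ″≤j j<d) w‴
...   | inj₁ ℓ′<d with from w′
...     | ℓ″ , ℓ″≤ℓ′ , w″ = contradiction w″ (below (≤-<-trans ℓ″≤ℓ′ ℓ′<d))

infixl 5 _∷ʳ_
_∷ʳ_ : ∀ {m} {G : FinGraph m} {ℓ x y z} → Walk G ℓ x y → Adj G y z → Walk G (suc ℓ) x z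
[]      ∷ʳ b = b ∷ []
(a ∷ w) ∷ʳ b = a ∷ (w ∷ʳ b)

reverse : ∀ {m} {G : FinGraph m} → (∀ {x y} → Adj G x y → Adj G y x) → ∀ {ℓ x y} → Walk G ℓ x y → Walk G ℓ y x
reverse adj-sym []      = []
reverse adj-sym (a ∷ w) = reverse adj-sym w ∷ʳ adj-sym a

module TwinProperties {m} (G : FinGraph m) where

  twin-refl : ∀ {x} → Twin G x x
  twin-refl _ = (λ p → p) , (λ p → p)

  twin-sym : ∀ {x y} → Twin G x y → Twin G y x
  twin-sym t w = proj₂ (t w) , proj₁ (t w)

  twin-adj : ∀ {x y z} → Twin G x y → Adj G y z → z ≢ x → Adj G x z
  twin-adj {z = z} t a z≢x = proj₁ (proj₂ (t z) (a , z≢x))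

  walk-twin-start : ∀ {ℓ u x y} → Twin G u x → x ≢ y → Walk G ℓ x y → ∃ λ ℓ′ → ℓ′ ≤ ℓ × Walk G ℓ′ u y
  walk-twin-start t x≢y [] = contradiction refl x≢y
  walk-twin-start {suc ℓ} {u} t _ (_∷_ {y = z} a w) with z ≟ u
  ... | yes refl = ℓ , n≤1+n ℓ , w
  ... | no z≢u   = suc ℓ , ≤-refl , twin-adj t a z≢u ∷ w

module TwinEquivalence {m} (G : FinGraph m)
  (adj-sym : ∀ {x y} → Adj G x y → Adj G y x)
  (adj-irrefl : ∀ {x y} → Adj G x y → x ≢ y)
  where

  open TwinProperties G

  twin-trans : ∀ {u v w} → Twin G u v → Twin G v w → Twin G u w
  twin-trans t₁ t₂ z = forth t₁ t₂ z , forth (twin-sym t₂) (twin-sym t₁) z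
    where
    forth : ∀ {u v w} → Twin G u v → Twin G v w → ∀ z → Adj G u z × z ≢ w → Adj G w z × z ≢ u
    forth {u} {v} {w} t₁ t₂ z (a , z≢w) = adj-wz , ≢-sym (adj-irrefl a)
      where
      adj-wz : Adj G w z
      adj-wz with z ≟ v | w ≟ u
      ... | no z≢v    | _        = twin-adj (twin-sym t₂) (twin-adj (twin-sym t₁) a z≢v) z≢w
      ... | yes refl  | yes refl = a
      ... | yes refl  | no w≢u   =
        adj-sym (twin-adj (twin-sym t₁) (adj-sym (twin-adj (twin-sym t₂) (adj-sym a) (≢-sym w≢u))) (≢-sym z≢w))

  twins-clique : ∀ {a b u v} → Twin G a b → Adj G a b → Twin G u a → Twin G v a → u ≢ v → Adj G u v
  twins-clique {a} {v = v} tab aab tua tva u≢v with v ≟ a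
  ... | yes refl = twin-adj (twin-trans tua tab) (adj-sym aab) (≢-sym u≢v)
  ... | no v≢a   = twin-adj tua (adj-sym (twin-adj (twin-trans tva tab) (adj-sym aab) (≢-sym v≢a))) (≢-sym u≢v)

module TwinDecomposition {m} (G : FinGraph m)
  (adj-sym : ∀ {x y} → Adj G x y → Adj G y x)
  (adj-irrefl : ∀ {x y} → Adj G x y → x ≢ y)
  (adj-vertex : ∀ {x y} → Adj G x y → V G x)
  (diameter≤3 : ∀ {x y} → V G x → V G y → ∃ λ ℓ → ℓ ≤ 3 × Walk G ℓ x y)
  {k} (c : Fin k → Fin m)
  (c-vertex : ∀ i → V G (c i))
  (c-distinct : ∀ i j → Twin G (c i) (c j) → i ≡ j)
  (c-cover : ∀ v → V G v → ∃ λ i → Twin G v (c i))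
  where

  open TwinProperties G
  open TwinEquivalence G adj-sym adj-irrefl

  H : FinGraph m
  H = repGraph G c

  same-class : ∀ {u i j} → Twin G u (c i) → Twin G u (c j) → i ≡ j
  same-class {i = i} {j} tu tu′ = c-distinct i j (twin-trans (twin-sym tu) tu′)

  c-injective : ∀ {i j} → c i ≡ c j → i ≡ j
  c-injective {i} {j} ci≡cj = c-distinct i j (subst (Twin G (c i)) ci≡cj twin-refl)

  isDistance-≤3 : ∀ {u v} → V G u → V G v → ∃ λ d → d ≤ 3 × IsDistance G u v d
  isDistance-≤3 vu vv with diameter≤3 vu vv
  ... | ℓ , ℓ≤3 , w with isDistance-exists G w
  ...   | d , d≤ℓ , isd = d , ≤-trans d≤ℓ ℓ≤3 , isd

  dist-sym : ∀ {u v} → V G u → V G v → dist G u v ≡ dist G v u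
  dist-sym vu vv with isDistance-≤3 vu vv
  ... | d , d≤3 , isd = trans (dist-isDistance G d≤3 isd) (sym (dist-isDistance G d≤3 (isDistance-transfer rev rev isd)))
    where
    rev : ∀ {x y} → ShorterWalks G x y G y x
    rev w = _ , ≤-refl , reverse adj-sym w

  dist-adjacent : ∀ {u v} → u ≢ v → Adj G u v → dist G u v ≡ 1
  dist-adjacent u≢v a = dist-isDistance G (s≤s z≤n) (a ∷ [] , λ where (s≤s z≤n) [] → u≢v refl)

  dist-twins-nonadjacent : ∀ {u v} → V G u → V G v → Twin G u v → u ≢ v → ¬ Adj G u v → dist G u v ≡ 2
  dist-twins-nonadjacent {u} {v} vu vv tuv u≢v ¬adj with diameter≤3 vu vv
  ... | _ , _ , [] = contradiction refl u≢v
  ... | _ , _ , _∷_ {y = a} ua _ =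
    dist-isDistance G (s≤s (s≤s z≤n)) (ua ∷ adj-sym va ∷ [] , shorter)
    where
    va : Adj G v a
    va = twin-adj (twin-sym tuv) ua (λ where refl → ¬adj ua)
    shorter : ∀ {j} → j < 2 → ¬ Walk G j u v
    shorter (s≤s z≤n)       []       = u≢v refl
    shorter (s≤s (s≤s z≤n)) (a ∷ []) = ¬adj a

  lift : ∀ {ℓ x y} → Walk H ℓ x y → Walk G ℓ x y
  lift []            = []
  lift ((a , _) ∷ w) = a ∷ lift w

  -- A step inside one twin class is dropped; any other step joins the two representatives.
  project : ∀ {ℓ x y i j} → Walk G ℓ x y → Twin G x (c i) → Twin G y (c j) →
            ∃ λ ℓ′ → ℓ′ ≤ ℓ × Walk H ℓ′ (c i) (c j)
  project [] tx ty with same-class tx ty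
  ... | refl = 0 , z≤n , []
  project {suc ℓ} {i = i} (_∷_ {y = z} a w) tx ty
    with i′ , tz ← c-cover z (adj-vertex (adj-sym a))
    with ℓ′ , ℓ′≤ℓ , w′ ← project w tz ty
    with i ≟ i′
  ... | yes refl = ℓ′ , m≤n⇒m≤1+n ℓ′≤ℓ , w′
  ... | no i≢i′  = suc ℓ′ , s≤s ℓ′≤ℓ , (adj-sym ci′-ci , (i , refl) , (i′ , refl)) ∷ w′
    where
    ci-z : Adj G (c i) z
    ci-z = twin-adj (twin-sym tx) a (λ where refl → i≢i′ (same-class twin-refl tz))
    ci′-ci : Adj G (c i′) (c i)
    ci′-ci = twin-adj (twin-sym tz) (adj-sym ci-z) (i≢i′ ∘ c-injective)

  unproject : ∀ {u v i j} → Twin G u (c i) → Twin G v (c j) → i ≢ j → ShorterWalks H (c i) (c j) G u v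
  unproject {u} {v} {i} {j} tu tv i≢j w
    with ℓ₁ , ℓ₁≤ℓ , w₁ ← walk-twin-start tu (i≢j ∘ c-injective) (lift w)
    with ℓ₂ , ℓ₂≤ℓ₁ , w₂ ← walk-twin-start tv (λ where refl → i≢j (same-class tu twin-refl)) (reverse adj-sym w₁)
    = ℓ₂ , ≤-trans ℓ₂≤ℓ₁ ℓ₁≤ℓ , reverse adj-sym w₂

  dist-between-classes : ∀ {u v i j} → V G u → V G v → Twin G u (c i) → Twin G v (c j) → i ≢ j →
                         dist G u v ≡ dist H (c i) (c j)
  dist-between-classes vu vv tu tv i≢j with isDistance-≤3 vu vv
  ... | d , d≤3 , isd = trans (dist-isDistance G d≤3 isd)
    (sym (dist-isDistance H d≤3 (isDistance-transfer (λ w → project w tu tv) (unproject tu tv i≢j) isd)))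

  adjacent-twins⇒complete : ∀ {u v i} → Twin G u (c i) → Twin G v (c i) → Adj G u v → ClassComplete G (c i)
  adjacent-twins⇒complete tu tv a _ _ (_ , tu′) (_ , tv′) =
    twins-clique (twin-trans tu (twin-sym tv)) a
      (twin-trans tu′ (twin-sym tu)) (twin-trans tv′ (twin-sym tu))

  incomplete⇒edgeless : ∀ i → ¬ ClassComplete G (c i) → ClassEdgeless G (c i)
  incomplete⇒edgeless i ¬complete _ _ (_ , tu) (_ , tv) a = ¬complete (adjacent-twins⇒complete tu tv a)

  twinDist : Fin k → ℕ
  twinDist i = if does (ClassComplete? G (c i)) then 1 else 2

  classDist : Fin k → Fin k → ℕ
  classDist i j = if does (i ≟ j) then twinDist i else dist H (c i) (c j)

  dist-via-classes : ∀ {u v i j} → V G u → V G v → Twin G u (c i) → Twin G v (c j) → u ≢ v →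
                     dist G u v ≡ classDist i j
  dist-via-classes {i = i} {j} vu vv tu tv u≢v with i ≟ j
  ... | no i≢j   = dist-between-classes vu vv tu tv i≢j
  ... | yes refl with ClassComplete? G (c i)
  ...   | yes complete rewrite dec-true (ClassComplete? G (c i)) complete =
    dist-adjacent u≢v (complete _ _ (vu , tu) (vv , tv) u≢v)
  ...   | no ¬complete rewrite dec-false (ClassComplete? G (c i)) ¬complete =
    dist-twins-nonadjacent vu vv (twin-trans tu (twin-sym tv)) u≢v (¬complete ∘ adjacent-twins⇒complete tu tv)

  member : Fin k → Fin m → ℕ
  member i u = ⟦ does (inClass? G (c i) u) ⟧

  member-twin : ∀ {u i} → V G u → Twin G u (c i) → ∀ j → member j u ≡ ⟦ does (i ≟ j) ⟧
  member-twin {i = i} vu tu j = cong ⟦_⟧ (does-⇔ (mk⇔ (same-class tu ∘ proj₂) (λ where refl → vu , tu)) (inClass? G (c j) _) (i ≟ j))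

  member-nonvertex : ∀ {u} → ¬ V G u → ∀ i → member i u ≡ 0
  member-nonvertex ¬vu i = ⟦no⟧ (inClass? G (c i) _) (¬vu ∘ proj₁)

  ∑-member : ∀ {u i} → V G u → Twin G u (c i) → (f : Fin k → ℕ) → ∑[ j < k ] (member j u * f j) ≡ f i
  ∑-member {i = i} vu tu f = trans (sum-cong-≗ (λ j → cong (_* f j) (member-twin vu tu j))) (∑-indicator i f)

  ∑-member-nonvertex : ∀ {u} → ¬ V G u → (f : Fin k → ℕ) → ∑[ j < k ] (member j u * f j) ≡ 0
  ∑-member-nonvertex ¬vu f = trans (sum-cong-≗ (λ j → cong (_* f j) (member-nonvertex ¬vu j))) (sum-replicate-zero k)

  member-disjoint : ∀ i j u → member i u * member j u ≡ ⟦ does (i ≟ j) ⟧ * member i u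
  member-disjoint i j u with i ≟ j
  ... | yes refl = trans (⟦⟧-idem _) (sym (*-identityˡ _))
  ... | no i≢j with inClass? G (c i) u
  ...   | no ¬in-i     = cong (_* member j u) (⟦no⟧ (inClass? G (c i) u) ¬in-i)
  ...   | yes (_ , ti) = trans (cong (member i u *_) (⟦no⟧ (inClass? G (c j) u) λ (_ , tj) → i≢j (same-class ti tj)))
                                 (*-zeroʳ (member i u))

  classSize-∑ : ∀ i → classSize G (c i) ≡ ∑[ u < m ] member i u
  classSize-∑ i = trans (length-filter (inClass? G (c i)) (allFin m)) (sum-map-tabulate (λ u → member i u) (λ u → u))

  size : Fin k → ℕ
  size i = classSize G (c i)

  orderedPairs : Fin k → Fin k → ℕ
  orderedPairs i j = ∑[ u < m ] ∑[ v < m ] (⟦ not (does (u ≟ v)) ⟧ * (member i u * member j v))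

  orderedPairs+diagonal : ∀ i j → orderedPairs i j + ⟦ does (i ≟ j) ⟧ * size i ≡ size i * size j
  orderedPairs+diagonal i j = begin
    orderedPairs i j + ⟦ does (i ≟ j) ⟧ * size i
      ≡⟨ cong (orderedPairs i j +_) diagonal ⟩
    orderedPairs i j + ∑[ u < m ] ∑[ v < m ] (⟦ does (u ≟ v) ⟧ * (member i u * member j v))
      ≡⟨ ∑-distrib-+ (λ u → ∑[ v < m ] (⟦ not (does (u ≟ v)) ⟧ * (member i u * member j v)))
                     (λ u → ∑[ v < m ] (⟦ does (u ≟ v) ⟧ * (member i u * member j v))) ⟨
    ∑[ u < m ] (∑[ v < m ] (⟦ not (does (u ≟ v)) ⟧ * (member i u * member j v))
               + ∑[ v < m ] (⟦ does (u ≟ v) ⟧ * (member i u * member j v)))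
      ≡⟨ sum-cong-≗ (λ u → trans (sym (∑-distrib-+ (λ v → ⟦ not (does (u ≟ v)) ⟧ * (member i u * member j v))
                                                  (λ v → ⟦ does (u ≟ v) ⟧ * (member i u * member j v))))
                                  (sum-cong-≗ (λ v → ⟦not⟧*+⟦⟧* (does (u ≟ v)) (member i u * member j v)))) ⟩
    ∑[ u < m ] ∑[ v < m ] (member i u * member j v)
      ≡⟨ ∑*∑ (member i) (member j) ⟨
    ∑[ u < m ] member i u * ∑[ v < m ] member j v
      ≡⟨ cong₂ _*_ (classSize-∑ i) (classSize-∑ j) ⟨
    size i * size j ∎
    where
    open ≡-Reasoning
    diagonal : ⟦ does (i ≟ j) ⟧ * size i ≡ ∑[ u < m ] ∑[ v < m ] (⟦ does (u ≟ v) ⟧ * (member i u * member j v))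
    diagonal = begin
      ⟦ does (i ≟ j) ⟧ * size i                  ≡⟨ cong (⟦ does (i ≟ j) ⟧ *_) (classSize-∑ i) ⟩
      ⟦ does (i ≟ j) ⟧ * ∑[ u < m ] member i u   ≡⟨ *-distribˡ-sum ⟦ does (i ≟ j) ⟧ (member i) ⟩
      ∑[ u < m ] (⟦ does (i ≟ j) ⟧ * member i u) ≡⟨ sum-cong-≗ (λ u → member-disjoint i j u) ⟨
      ∑[ u < m ] (member i u * member j u)       ≡⟨ sum-cong-≗ (λ u → ∑-indicator u (λ v → member i u * member j v)) ⟨
      ∑[ u < m ] ∑[ v < m ] (⟦ does (u ≟ v) ⟧ * (member i u * member j v)) ∎

  orderedPairs-between : ∀ {i j} → i ≢ j → orderedPairs i j ≡ size i * size j
  orderedPairs-between {i} {j} i≢j = begin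
    orderedPairs i j                              ≡⟨ +-identityʳ _ ⟨
    orderedPairs i j + 0 * size i                 ≡⟨ cong (λ b → orderedPairs i j + ⟦ b ⟧ * size i) (dec-false (i ≟ j) i≢j) ⟨
    orderedPairs i j + ⟦ does (i ≟ j) ⟧ * size i  ≡⟨ orderedPairs+diagonal i j ⟩
    size i * size j                               ∎
    where open ≡-Reasoning

  orderedPairs-within : ∀ i → orderedPairs i i ≡ 2 * (size i C 2)
  orderedPairs-within i = +-cancelʳ-≡ (size i) _ _ (begin
    orderedPairs i i + size i                     ≡⟨ cong (orderedPairs i i +_) (+-identityʳ (size i)) ⟨
    orderedPairs i i + 1 * size i                 ≡⟨ cong (λ b → orderedPairs i i + ⟦ b ⟧ * size i) (dec-true (i ≟ i) refl) ⟨
    orderedPairs i i + ⟦ does (i ≟ i) ⟧ * size i  ≡⟨ orderedPairs+diagonal i i ⟩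
    size i * size i                               ≡⟨ 2*C2+n≡n*n (size i) ⟨
    2 * (size i C 2) + size i                     ∎)
    where open ≡-Reasoning

  orderedPairs-complete-edgeless : ∀ i → ClassComplete G (c i) → ClassEdgeless G (c i) → orderedPairs i i ≡ 0
  orderedPairs-complete-edgeless i complete edgeless =
    trans (sum-cong-≗ (λ u → trans (sum-cong-≗ (λ v → no-pair u v)) (sum-replicate-zero m))) (sum-replicate-zero m)
    where
    no-pair : ∀ u v → ⟦ not (does (u ≟ v)) ⟧ * (member i u * member i v) ≡ 0
    no-pair u v with u ≟ v
    ... | yes _  = refl
    ... | no u≢v = trans (*-identityˡ _) (trans (sym (⟦∧⟧ (does (inClass? G (c i) u)) (does (inClass? G (c i) v))))
      (⟦no⟧ (inClass? G (c i) u ×-dec inClass? G (c i) v) λ (iu , iv) → edgeless u v iu iv (complete u v iu iv u≢v)))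

  vertexDist : Fin m → Fin m → ℕ
  vertexDist u v = ⟦ does (V? G u) ∧ does (V? G v) ⟧ * dist G u v

  vertexDist-sym : ∀ u v → vertexDist u v ≡ vertexDist v u
  vertexDist-sym u v with V? G u | V? G v
  ... | yes vu | yes vv = cong (1 *_) (dist-sym vu vv)
  ... | yes _  | no _   = refl
  ... | no _   | yes _  = refl
  ... | no _   | no _   = refl

  2W≡∑vertexDist : 2 * W G ≡ ∑[ u < m ] ∑[ v < m ] (⟦ not (does (u ≟ v)) ⟧ * vertexDist u v)
  2W≡∑vertexDist = trans (cong (2 *_) W≡∑) (∑-upper-triangle vertexDist vertexDist-sym)
    where
    W≡∑ : W G ≡ ∑[ u < m ] ∑[ v < m ] (⟦ does (u <? v) ⟧ * vertexDist u v)
    W≡∑ = trans (sum-filter-allFin² (λ (u , v) → (u <? v) ×-dec V? G u ×-dec V? G v) (λ (u , v) → dist G u v))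
                (sum-cong-≗ λ u → sum-cong-≗ λ v →
                   trans (cong (_* dist G u v) (⟦∧⟧ (does (u <? v)) (does (V? G u) ∧ does (V? G v))))
                         (*-assoc ⟦ does (u <? v) ⟧ ⟦ does (V? G u) ∧ does (V? G v) ⟧ (dist G u v)))

  classExpansion : Fin m → Fin m → ℕ
  classExpansion u v = ∑[ i < k ] (member i u * ∑[ j < k ] (member j v * classDist i j))

  classExpansion-nonvertex : ∀ {u v} → ¬ (V G u × V G v) → classExpansion u v ≡ 0
  classExpansion-nonvertex {u} {v} ¬both = by-cases (V? G u)
    where
    by-cases : Dec (V G u) → classExpansion u v ≡ 0
    by-cases (no ¬vu) = ∑-member-nonvertex ¬vu _
    by-cases (yes vu) = trans (sum-cong-≗ λ i → trans (cong (member i u *_) (∑-member-nonvertex (λ vv → ¬both (vu , vv)) _))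
                                                     (*-zeroʳ (member i u)))
                              (sum-replicate-zero k)

  vertexDist-expansion : ∀ {u v} → u ≢ v → vertexDist u v ≡ classExpansion u v
  vertexDist-expansion {u} {v} u≢v with V? G u ×-dec V? G v
  ... | no ¬both = trans (cong (_* dist G u v) (⟦no⟧ (V? G u ×-dec V? G v) ¬both)) (sym (classExpansion-nonvertex ¬both))
  ... | yes (vu , vv) with i , tu ← c-cover u vu | j , tv ← c-cover v vv = begin
    vertexDist u v                                ≡⟨ cong (_* dist G u v) (⟦yes⟧ (V? G u ×-dec V? G v) (vu , vv)) ⟩
    1 * dist G u v                                ≡⟨ *-identityˡ _ ⟩
    dist G u v                                    ≡⟨ dist-via-classes vu vv tu tv u≢v ⟩
    classDist i j                                 ≡⟨ ∑-member vv tv (classDist i) ⟨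
    ∑[ j < k ] (member j v * classDist i j)       ≡⟨ ∑-member vu tu (λ i → ∑[ j < k ] (member j v * classDist i j)) ⟨
    classExpansion u v                            ∎
    where open ≡-Reasoning

  2W≡∑orderedPairs : 2 * W G ≡ ∑[ i < k ] ∑[ j < k ] (orderedPairs i j * classDist i j)
  2W≡∑orderedPairs = begin
    2 * W G
      ≡⟨ 2W≡∑vertexDist ⟩
    ∑[ u < m ] ∑[ v < m ] (⟦ not (does (u ≟ v)) ⟧ * vertexDist u v)
      ≡⟨ sum-cong-≗ (λ u → sum-cong-≗ (λ v → ⟦⟧*-cong (¬? (u ≟ v)) vertexDist-expansion)) ⟩
    ∑[ u < m ] ∑[ v < m ] (⟦ not (does (u ≟ v)) ⟧ * classExpansion u v)
      ≡⟨ sum-cong-≗ (λ u → sum-cong-≗ (λ v → *-distrib-∑∑ ⟦ not (does (u ≟ v)) ⟧ (λ i → member i u) (λ j → member j v) classDist)) ⟩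
    ∑[ u < m ] ∑[ v < m ] ∑[ i < k ] ∑[ j < k ] ((⟦ not (does (u ≟ v)) ⟧ * (member i u * member j v)) * classDist i j)
      ≡⟨ ∑²-comm (λ u v i j → (⟦ not (does (u ≟ v)) ⟧ * (member i u * member j v)) * classDist i j) ⟩
    ∑[ i < k ] ∑[ j < k ] ∑[ u < m ] ∑[ v < m ] ((⟦ not (does (u ≟ v)) ⟧ * (member i u * member j v)) * classDist i j)
      ≡⟨ sum-cong-≗ (λ i → sum-cong-≗ (λ j → ∑∑-*ʳ (λ u v → ⟦ not (does (u ≟ v)) ⟧ * (member i u * member j v)) (classDist i j))) ⟩
    ∑[ i < k ] ∑[ j < k ] (orderedPairs i j * classDist i j) ∎
    where open ≡-Reasoning

  dH : Fin k → Fin k → ℕ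
  dH i j = dist H (c i) (c j)

  dH-sym : ∀ i j → dH i j ≡ dH j i
  dH-sym i j with i ≟ j
  ... | yes refl = refl
  ... | no i≢j = begin
    dist H (c i) (c j) ≡⟨ dist-between-classes (c-vertex i) (c-vertex j) twin-refl twin-refl i≢j ⟨
    dist G (c i) (c j) ≡⟨ dist-sym (c-vertex i) (c-vertex j) ⟩
    dist G (c j) (c i) ≡⟨ dist-between-classes (c-vertex j) (c-vertex i) twin-refl twin-refl (≢-sym i≢j) ⟩
    dist H (c j) (c i) ∎
    where open ≡-Reasoning

  betweenClasses : Fin k → Fin k → ℕ
  betweenClasses i j = size i * size j * dH i j

  ∑orderedPairs-split : ∀ i → ∑[ j < k ] (orderedPairs i j * classDist i j)
                            ≡ orderedPairs i i * twinDist i + ∑[ j < k ] (⟦ not (does (i ≟ j)) ⟧ * betweenClasses i j)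
  ∑orderedPairs-split i = begin
    ∑[ j < k ] (orderedPairs i j * classDist i j)
      ≡⟨ sum-cong-≗ split ⟩
    ∑[ j < k ] (⟦ does (i ≟ j) ⟧ * (orderedPairs i j * twinDist i) + ⟦ not (does (i ≟ j)) ⟧ * betweenClasses i j)
      ≡⟨ ∑-distrib-+ (λ j → ⟦ does (i ≟ j) ⟧ * (orderedPairs i j * twinDist i)) (λ j → ⟦ not (does (i ≟ j)) ⟧ * betweenClasses i j) ⟩
    ∑[ j < k ] (⟦ does (i ≟ j) ⟧ * (orderedPairs i j * twinDist i)) + ∑[ j < k ] (⟦ not (does (i ≟ j)) ⟧ * betweenClasses i j)
      ≡⟨ cong (_+ ∑[ j < k ] (⟦ not (does (i ≟ j)) ⟧ * betweenClasses i j)) (∑-indicator i (λ j → orderedPairs i j * twinDist i)) ⟩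
    orderedPairs i i * twinDist i + ∑[ j < k ] (⟦ not (does (i ≟ j)) ⟧ * betweenClasses i j) ∎
    where
    open ≡-Reasoning
    split : ∀ j → orderedPairs i j * classDist i j
                ≡ ⟦ does (i ≟ j) ⟧ * (orderedPairs i j * twinDist i) + ⟦ not (does (i ≟ j)) ⟧ * betweenClasses i j
    split j with i ≟ j
    ... | yes refl = sym (trans (+-identityʳ _) (*-identityˡ _))
    ... | no i≢j   = trans (cong (_* dH i j) (orderedPairs-between i≢j)) (sym (*-identityˡ _))

  completeTerm edgelessTerm : Fin k → ℕ
  completeTerm i = if does (ClassComplete? G (c i)) then size i C 2 else 0
  edgelessTerm i = if does (ClassEdgeless? G (c i)) then 2 * (size i C 2) else 0

  classTerm : ∀ i → 2 * (completeTerm i + edgelessTerm i) ≡ orderedPairs i i * twinDist i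
  classTerm i = by-cases (ClassComplete? G (c i)) (ClassEdgeless? G (c i))
    where
    open ≡-Reasoning
    by-cases : Dec (ClassComplete G (c i)) → Dec (ClassEdgeless G (c i)) →
               2 * (completeTerm i + edgelessTerm i) ≡ orderedPairs i i * twinDist i
    by-cases (yes complete) (yes edgeless)
      rewrite dec-true (ClassComplete? G (c i)) complete | dec-true (ClassEdgeless? G (c i)) edgeless = begin
      2 * (size i C 2 + 2 * (size i C 2))  ≡⟨ cong (λ x → 2 * (x + 2 * x)) no-pairs ⟩
      0                                    ≡⟨ cong (_* 1) (orderedPairs-complete-edgeless i complete edgeless) ⟨
      orderedPairs i i * 1                 ∎
      where
      no-pairs : size i C 2 ≡ 0
      no-pairs = *-cancelˡ-≡ (size i C 2) 0 2
        (trans (sym (orderedPairs-within i)) (orderedPairs-complete-edgeless i complete edgeless))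
    by-cases (yes complete) (no ¬edgeless)
      rewrite dec-true (ClassComplete? G (c i)) complete | dec-false (ClassEdgeless? G (c i)) ¬edgeless = begin
      2 * (size i C 2 + 0)  ≡⟨ cong (2 *_) (+-identityʳ (size i C 2)) ⟩
      2 * (size i C 2)      ≡⟨ orderedPairs-within i ⟨
      orderedPairs i i      ≡⟨ *-identityʳ (orderedPairs i i) ⟨
      orderedPairs i i * 1  ∎
    by-cases (no ¬complete) (yes edgeless)
      rewrite dec-false (ClassComplete? G (c i)) ¬complete | dec-true (ClassEdgeless? G (c i)) edgeless = begin
      2 * (2 * (size i C 2))  ≡⟨ cong (2 *_) (orderedPairs-within i) ⟨
      2 * orderedPairs i i    ≡⟨ *-comm 2 (orderedPairs i i) ⟩
      orderedPairs i i * 2    ∎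
    by-cases (no ¬complete) (no ¬edgeless) = contradiction (incomplete⇒edgeless i ¬complete) ¬edgeless

  Σcomplete Σedgeless Σbetween : ℕ
  Σcomplete = sum (map completeTerm (allFin k))
  Σedgeless = sum (map edgelessTerm (allFin k))
  Σbetween  = sum (map (λ (i , j) → betweenClasses i j) (filter (λ (i , j) → i <? j) (cartesianProduct (allFin k) (allFin k))))

  2*Σwithin : 2 * (Σcomplete + Σedgeless) ≡ ∑[ i < k ] (orderedPairs i i * twinDist i)
  2*Σwithin = begin
    2 * (Σcomplete + Σedgeless)
      ≡⟨ cong₂ (λ x y → 2 * (x + y)) (sum-map-tabulate completeTerm (λ i → i)) (sum-map-tabulate edgelessTerm (λ i → i)) ⟩
    2 * (∑[ i < k ] completeTerm i + ∑[ i < k ] edgelessTerm i)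
      ≡⟨ cong (2 *_) (∑-distrib-+ completeTerm edgelessTerm) ⟨
    2 * ∑[ i < k ] (completeTerm i + edgelessTerm i)
      ≡⟨ *-distribˡ-sum 2 (λ i → completeTerm i + edgelessTerm i) ⟩
    ∑[ i < k ] (2 * (completeTerm i + edgelessTerm i))
      ≡⟨ sum-cong-≗ classTerm ⟩
    ∑[ i < k ] (orderedPairs i i * twinDist i) ∎
    where open ≡-Reasoning

  2*Σbetween : 2 * Σbetween ≡ ∑[ i < k ] ∑[ j < k ] (⟦ not (does (i ≟ j)) ⟧ * betweenClasses i j)
  2*Σbetween = trans (cong (2 *_) (sum-filter-allFin² (λ (i , j) → i <? j) (λ (i , j) → betweenClasses i j)))
    (∑-upper-triangle betweenClasses λ i j → cong₂ _*_ (*-comm (size i) (size j)) (dH-sym i j))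

  2W≡within+between : 2 * W G ≡ ∑[ i < k ] (orderedPairs i i * twinDist i)
                                + ∑[ i < k ] ∑[ j < k ] (⟦ not (does (i ≟ j)) ⟧ * betweenClasses i j)
  2W≡within+between = begin
    2 * W G
      ≡⟨ 2W≡∑orderedPairs ⟩
    ∑[ i < k ] ∑[ j < k ] (orderedPairs i j * classDist i j)
      ≡⟨ sum-cong-≗ ∑orderedPairs-split ⟩
    ∑[ i < k ] (orderedPairs i i * twinDist i + ∑[ j < k ] (⟦ not (does (i ≟ j)) ⟧ * betweenClasses i j))
      ≡⟨ ∑-distrib-+ (λ i → orderedPairs i i * twinDist i) (λ i → ∑[ j < k ] (⟦ not (does (i ≟ j)) ⟧ * betweenClasses i j)) ⟩
    ∑[ i < k ] (orderedPairs i i * twinDist i) + ∑[ i < k ] ∑[ j < k ] (⟦ not (does (i ≟ j)) ⟧ * betweenClasses i j) ∎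
    where open ≡-Reasoning

  W≡twinFormula : W G ≡ twinFormula G k c
  W≡twinFormula = *-cancelˡ-≡ (W G) (twinFormula G k c) 2 (begin
    2 * W G
      ≡⟨ 2W≡within+between ⟩
    ∑[ i < k ] (orderedPairs i i * twinDist i) + ∑[ i < k ] ∑[ j < k ] (⟦ not (does (i ≟ j)) ⟧ * betweenClasses i j)
      ≡⟨ cong₂ _+_ 2*Σwithin 2*Σbetween ⟨
    2 * (Σcomplete + Σedgeless) + 2 * Σbetween
      ≡⟨ *-distribˡ-+ 2 (Σcomplete + Σedgeless) Σbetween ⟨
    2 * twinFormula G k c ∎)
    where open ≡-Reasoning

module _ {m} (R : FinCommRing m) (I : Ideal R) where
  open FinCommRing R using (isCommutativeRing) renaming (_*_ to _·_)
  open IsCommutativeRing isCommutativeRing using () renaming (*-comm to ·-comm; *-assoc to ·-assoc)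
  open Ideal I renaming (carrier to S)

  private
    ∈-*ʳ : ∀ {x} y → x ∈ S → (x · y) ∈ S
    ∈-*ʳ {x} y x∈ = subst (_∈ S) (·-comm y x) (*-closed y x∈)

    ∈-comm : ∀ {x y} → (x · y) ∈ S → (y · x) ∈ S
    ∈-comm {x} {y} = subst (_∈ S) (·-comm x y)

  Γ-adj-sym : ∀ {x y} → ΓAdj R I x y → ΓAdj R I y x
  Γ-adj-sym (vx , vy , x≢y , xy∈) = vy , vx , ≢-sym x≢y , ∈-comm xy∈

  Γ-adj-irrefl : ∀ {x y} → ΓAdj R I x y → x ≢ y
  Γ-adj-irrefl (_ , _ , x≢y , _) = x≢y

  Γ-adj-vertex : ∀ {x y} → ΓAdj R I x y → ΓV R I x
  Γ-adj-vertex = proj₁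

  Γ-edge : ∀ {x y} → x ∉ S → y ∉ S → x ≢ y → (x · y) ∈ S → ΓAdj R I x y
  Γ-edge {x} {y} x∉ y∉ x≢y xy∈ = (x∉ , y , y∉ , xy∈) , (y∉ , x , x∉ , ∈-comm xy∈) , x≢y , xy∈

  Γ-common-neighbour : ∀ {x y z} → x ∉ S → y ∉ S → z ∉ S → (x · y) ∉ S →
                       (x · z) ∈ S → (z · y) ∈ S → Walk (Γ R I) 2 x y
  Γ-common-neighbour x∉ y∉ z∉ xy∉ xz∈ zy∈ =
    Γ-edge x∉ z∉ (λ where refl → xy∉ zy∈) xz∈ ∷ Γ-edge z∉ y∉ (λ where refl → xy∉ xz∈) zy∈ ∷ []

  -- Redmond's argument: when xy ∉ I, a witness a of x, a witness b of y, or ab is a common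
  -- neighbour, or else x – a – b – y is a walk.  Every inequality between these vertices
  -- that an edge requires is forced by the membership facts at hand.
  Γ-diameter≤3 : ∀ {x y} → ΓV R I x → ΓV R I y → ∃ λ ℓ → ℓ ≤ 3 × Walk (Γ R I) ℓ x y
  Γ-diameter≤3 {x} {y} (x∉ , a , a∉ , xa∈) (y∉ , b , b∉ , yb∈)
    with x ≟ y | (x · y) ∈? S
  ... | yes refl | _       = 0 , z≤n , []
  ... | no x≢y   | yes xy∈ = 1 , s≤s z≤n , Γ-edge x∉ y∉ x≢y xy∈ ∷ []
  ... | no _     | no xy∉
    with (a · y) ∈? S | (x · b) ∈? S | (a · b) ∈? S
  ... | yes ay∈ | _       | _       = 2 , s≤s (s≤s z≤n) , Γ-common-neighbour x∉ y∉ a∉ xy∉ xa∈ ay∈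
  ... | no _    | yes xb∈ | _       = 2 , s≤s (s≤s z≤n) , Γ-common-neighbour x∉ y∉ b∉ xy∉ xb∈ (∈-comm yb∈)
  ... | no _    | no _    | no ab∉  = 2 , s≤s (s≤s z≤n) , Γ-common-neighbour x∉ y∉ ab∉ xy∉ xab∈ aby∈
    where
    xab∈ : (x · (a · b)) ∈ S
    xab∈ = subst (_∈ S) (·-assoc x a b) (∈-*ʳ b xa∈)
    aby∈ : ((a · b) · y) ∈ S
    aby∈ = subst (_∈ S) (sym (·-assoc a b y)) (*-closed a (∈-comm yb∈))
  ... | no ay∉  | no xb∉  | yes ab∈ = 3 , s≤s (s≤s (s≤s z≤n)) ,
    Γ-edge x∉ a∉ (λ where refl → xb∉ ab∈) xa∈ ∷
    Γ-edge a∉ b∉ (λ where refl → ay∉ (∈-comm yb∈)) ab∈ ∷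
    Γ-edge b∉ y∉ (λ where refl → ay∉ ab∈) (∈-comm yb∈) ∷ []

lemma5p7 : ∀ {m : ℕ} (R : FinCommRing m) (I : Ideal R)
           (k : ℕ) (c : Fin k → Fin m)
           → (∀ i → V (Γ R I) (c i))
           → (∀ i j → Twin (Γ R I) (c i) (c j) → i ≡ j)
           → (∀ v → V (Γ R I) v → ∃ λ i → Twin (Γ R I) v (c i))
           → W (Γ R I) ≡ twinFormula (Γ R I) k c
lemma5p7 R I k c c-vertex c-distinct c-cover =
  TwinDecomposition.W≡twinFormula (Γ R I) (Γ-adj-sym R I) (Γ-adj-irrefl R I) (Γ-adj-vertex R I) (Γ-diameter≤3 R I)
    c c-vertex c-distinct c-cover
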